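{- Let $(G,k)$ be a YES-instance of Annotated EWCD in which $G$ has no isolated vertices. Then there exists a solution $B$ such that for every pair of vertices $u,v$ that are $\star$-twins in $G$, the set of cliques containing $u$ is not a proper subset of the set of cliques containing $v$, and vice versa (i.e. $B_u\not\subset B_v$ and $B_v\not\subset B_u$, viewing signatures as sets of clique indices).
   Context: Annotated EWCD (AEWCD): input is a graph $G=(V,E)$ with non-negative edge weights $w_e$, a set $S\subseteq V$ with non-negative vertex weights $w_v$ ($v\in S$), and a positive integer $k$; a solution is a set of at most $k$ cliques $C_1,\dots,C_k$ with weights $\gamma_1,\dots,\gamma_k\ge 0$ such that $w_{uv}=\sum_{i:\,uv\in C_i}\gamma_i$ for all $uv\in E$ and $w_v=\sum_{i:\,v\in C_i}\gamma_i$ for all $v\in S$; it is a YES-instance if a solution exists. The signature $B_u\in\{0,1\}^k$ of $u$ has $B_{u,j}=1$ iff $u\in C_j$. Let $A$ be the symmetric matrix with $A_{uv}=w_{uv}$ for edges, $A_{uv}=0$ for non-adjacent $u\neq v$, $A_{vv}=w_v$ for $v\in S$ and $A_{vv}=\star$ (wildcard) otherwise; $a\stackrel{\star}{=}b$ means $a=b$, $a=\star$ or $b=\star$. Distinct $u,v$ are $\star$-twins if they are adjacent and $A_u\stackrel{\star}{=}A_v$ entrywise on rows.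
   Formalization: The edge weights, the vertex weights and the clique weights γ_i take values in the non-negative rationals instead of the non-negative reals. -}

module Defs where

open import Data.Nat using (ℕ; zero; suc)
open import Data.Fin using (Fin; zero; suc)
open import Data.Bool using (Bool; true; false; if_then_else_; _∧_; T)
open import Data.Maybe using (Maybe; just; nothing)
open import Data.Rational using (ℚ; 0ℚ; _+_; _≤_)
open import Data.Product using (Σ; _×_; ∃; ∃-syntax)
open import Data.Sum using (_⊎_)
open import Relation.Nullary using (¬_; yes; no)
open import Relation.Binary.PropositionalEquality using (_≡_)
import Data.Fin.Properties as FinP

record Graph (n : ℕ) : Set where
  field
    adj     : Fin n → Fin n → Bool
    adj-sym : ∀ u v → adj u v ≡ adj v u
    adj-irr : ∀ v → adj v v ≡ false
open Graph public

sumFin : (k : ℕ) → (Fin k → ℚ) → ℚ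
sumFin zero    f = 0ℚ
sumFin (suc k) f = f zero + sumFin k (λ i → f (suc i))

-- An AEWCD instance on n vertices: graph, edge weights (a symmetric
-- function, only its values on edges matter), the set S (as a Boolean
-- predicate) and vertex weights (only values on S matter), plus k.
record Instance (n : ℕ) : Set where
  field
    graph   : Graph n
    ew      : Fin n → Fin n → ℚ
    ew-sym  : ∀ u v → ew u v ≡ ew v u
    ew-nonneg : ∀ u v → T (adj graph u v) → 0ℚ ≤ ew u v
    inS     : Fin n → Bool
    vw      : Fin n → ℚ
    vw-nonneg : ∀ v → T (inS v) → 0ℚ ≤ vw v
    k       : ℕ
open Instance public

-- Candidate solution: k (possibly empty) vertex sets given by membership
-- B v j  ("v ∈ C_j", i.e. the signature of v), and weights γ_j.
record Candidate (n k : ℕ) : Set where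
  field
    B : Fin n → Fin k → Bool
    γ : Fin k → ℚ
open Candidate public

pairWeight : ∀ {n k} → Candidate n k → Fin n → Fin n → ℚ
pairWeight {k = k} c u v = sumFin k (λ j → if B c u j ∧ B c v j then γ c j else 0ℚ)

vertexWeight : ∀ {n k} → Candidate n k → Fin n → ℚ
vertexWeight {k = k} c v = sumFin k (λ j → if B c v j then γ c j else 0ℚ)

record IsSolution {n : ℕ} (I : Instance n) (c : Candidate n (k I)) : Set where
  field
    cliques   : ∀ j u v → ¬ (u ≡ v) → T (B c u j) → T (B c v j) → T (adj (graph I) u v)
    γ-nonneg  : ∀ j → 0ℚ ≤ γ c j
    edge-eq   : ∀ u v → T (adj (graph I) u v) → ew I u v ≡ pairWeight c u v
    vertex-eq : ∀ v → T (inS I v) → vw I v ≡ vertexWeight c v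

YesInstance : ∀ {n} → Instance n → Set
YesInstance I = Σ (Candidate _ (k I)) (IsSolution I)

NoIsolated : ∀ {n} → Graph n → Set
NoIsolated G = ∀ v → ∃[ u ] T (adj G v u)

-- The matrix A (⋆ = nothing).
A : ∀ {n} → Instance n → Fin n → Fin n → Maybe ℚ
A I u v with u FinP.≟ v
... | yes _ = if inS I u then just (vw I u) else nothing
... | no  _ = if adj (graph I) u v then just (ew I u v) else just 0ℚ

_≡⋆_ : Maybe ℚ → Maybe ℚ → Set
a ≡⋆ b = (a ≡ b) ⊎ (a ≡ nothing) ⊎ (b ≡ nothing)

StarTwins : ∀ {n} → Instance n → Fin n → Fin n → Set
StarTwins I u v = ¬ (u ≡ v) × T (adj (graph I) u v) × (∀ x → A I u x ≡⋆ A I v x)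

_⊂sig_ : ∀ {k} → (Fin k → Bool) → (Fin k → Bool) → Set
_⊂sig_ {k} Bu Bv = (∀ j → T (Bu j) → T (Bv j)) × (∃[ j ] (T (Bv j) × ¬ T (Bu j)))

module Submission where

-- First normalise a solution: drop v from C_j unless γ_j > 0 and
-- the membership is needed, i.e. v ∈ S or C_j contains a second vertex.  No sum
-- w_uv (uv ∈ E) or w_v (v ∈ S) changes, so this is again a solution.  Now let
-- u, v be ⋆-twins with B_u ⊊ B_v and take C_j ∋ v with u ∉ C_j.  If v ∈ S, then
-- w_uv = A_uv = A_vv = w_v, yet the cliques through v outweigh those through uv
-- by at least γ_j > 0.  Otherwise C_j contains some x ∉ {u, v}, and
-- A_ux ≤ Σ_{C ∋ u,x} γ_C < Σ_{C ∋ v,x} γ_C = A_vx, contradicting A_ux = A_vx.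

open import Defs
open import Data.Nat using (ℕ; zero; suc)
open import Data.Fin using (Fin; zero; suc)
import Data.Fin.Properties as Fin
open import Data.Bool using (Bool; true; false; if_then_else_; _∧_; T)
open import Data.Bool.Properties using (T-∧)
open import Data.Maybe using (Maybe; just)
open import Data.Rational using (ℚ; 0ℚ; _+_; _≤_; _<_)
open import Data.Rational.Properties
  using (≤-refl; ≤-reflexive; ≤-antisym; ≮⇒≥; <-irrefl; ≤-<-trans;
         +-mono-≤; +-mono-<-≤; +-mono-≤-<; +-identityˡ; _<?_)
open import Data.Product using (Σ; _×_; _,_; ∃; proj₁; proj₂)
open import Data.Sum using (_⊎_; inj₁; inj₂)
open import Data.Empty using (⊥-elim)
open import Data.Unit using (tt)
open import Function using (_∘_)
open import Function.Bundles using (Equivalence)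
open import Relation.Nullary using (¬_; Dec; yes; no; ¬?)
open import Relation.Nullary.Decidable using (⌊_⌋; toWitness; fromWitness; T?; _×-dec_; _⊎-dec_)
open import Relation.Binary.PropositionalEquality
  using (_≡_; _≢_; refl; sym; trans; cong₂; subst; subst₂; module ≡-Reasoning)

T-∧-intro : ∀ {a b} → T a → T b → T (a ∧ b)
T-∧-intro ta tb = Equivalence.from T-∧ (ta , tb)

T-∧-elim : ∀ {a b} → T (a ∧ b) → T a × T b
T-∧-elim = Equivalence.to T-∧

sumFin-cong : ∀ k {f g : Fin k → ℚ} → (∀ i → f i ≡ g i) → sumFin k f ≡ sumFin k g
sumFin-cong zero    f≡g = refl
sumFin-cong (suc k) f≡g = cong₂ _+_ (f≡g zero) (sumFin-cong k (f≡g ∘ suc))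

sumFin-nonneg : ∀ k {f : Fin k → ℚ} → (∀ i → 0ℚ ≤ f i) → 0ℚ ≤ sumFin k f
sumFin-nonneg zero    f≥0 = ≤-refl
sumFin-nonneg (suc k) {f} f≥0 =
  subst (_≤ sumFin (suc k) f) (+-identityˡ 0ℚ) (+-mono-≤ (f≥0 zero) (sumFin-nonneg k (f≥0 ∘ suc)))

sumFin-mono-≤ : ∀ k {f g : Fin k → ℚ} → (∀ i → f i ≤ g i) → sumFin k f ≤ sumFin k g
sumFin-mono-≤ zero    f≤g = ≤-refl
sumFin-mono-≤ (suc k) f≤g = +-mono-≤ (f≤g zero) (sumFin-mono-≤ k (f≤g ∘ suc))

sumFin-mono-< : ∀ k {f g : Fin k → ℚ} → (∀ i → f i ≤ g i) →
                ∀ j → f j < g j → sumFin k f < sumFin k g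
sumFin-mono-< (suc k) f≤g zero    fj<gj = +-mono-<-≤ fj<gj (sumFin-mono-≤ k (f≤g ∘ suc))
sumFin-mono-< (suc k) f≤g (suc j) fj<gj = +-mono-≤-< (f≤g zero) (sumFin-mono-< k (f≤g ∘ suc) j fj<gj)

if-0-nonneg : ∀ b {q} → 0ℚ ≤ q → 0ℚ ≤ (if b then q else 0ℚ)
if-0-nonneg false q≥0 = ≤-refl
if-0-nonneg true  q≥0 = q≥0

if-0-mono-≤ : ∀ {a b q} → 0ℚ ≤ q → (T a → T b) → (if a then q else 0ℚ) ≤ (if b then q else 0ℚ)
if-0-mono-≤ {false} {false} q≥0 a⇒b = ≤-refl
if-0-mono-≤ {false} {true}  q≥0 a⇒b = q≥0
if-0-mono-≤ {true}  {false} q≥0 a⇒b = ⊥-elim (a⇒b tt)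
if-0-mono-≤ {true}  {true}  q≥0 a⇒b = ≤-refl

if-0-mono-< : ∀ {a b q} → 0ℚ < q → ¬ T a → T b → (if a then q else 0ℚ) < (if b then q else 0ℚ)
if-0-mono-< {false} {true} q>0 ¬a b = q>0
if-0-mono-< {true}         q>0 ¬a b = ⊥-elim (¬a tt)

if-0-cong : ∀ {a b q} → (T a → T b) → (T b → T a ⊎ q ≡ 0ℚ) →
            (if a then q else 0ℚ) ≡ (if b then q else 0ℚ)
if-0-cong {false} {false} a⇒b b⇒a = refl
if-0-cong {false} {true}  a⇒b b⇒a with b⇒a tt
... | inj₂ q≡0 = sym q≡0
if-0-cong {true}  {false} a⇒b b⇒a = ⊥-elim (a⇒b tt)
if-0-cong {true}  {true}  a⇒b b⇒a = refl

sumWhere : ∀ k → (Fin k → Bool) → (Fin k → ℚ) → ℚ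
sumWhere k P γ = sumFin k (λ j → if P j then γ j else 0ℚ)

sumWhere-nonneg : ∀ k P {γ : Fin k → ℚ} → (∀ j → 0ℚ ≤ γ j) → 0ℚ ≤ sumWhere k P γ
sumWhere-nonneg k P γ≥0 = sumFin-nonneg k (λ j → if-0-nonneg (P j) (γ≥0 j))

sumWhere-mono-< : ∀ k {P Q : Fin k → Bool} {γ : Fin k → ℚ} → (∀ j → 0ℚ ≤ γ j) →
                  (∀ j → T (P j) → T (Q j)) → ∀ j → ¬ T (P j) → T (Q j) → 0ℚ < γ j →
                  sumWhere k P γ < sumWhere k Q γ
sumWhere-mono-< k γ≥0 P⊆Q j ¬Pj Qj γj>0 =
  sumFin-mono-< k (λ i → if-0-mono-≤ (γ≥0 i) (P⊆Q i)) j (if-0-mono-< γj>0 ¬Pj Qj)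

≡⋆-just : ∀ {a b : ℚ} → just a ≡⋆ just b → a ≡ b
≡⋆-just (inj₁ refl) = refl
≡⋆-just (inj₂ (inj₁ ()))
≡⋆-just (inj₂ (inj₂ ()))

≡⋆-sym : ∀ {a b : Maybe ℚ} → a ≡⋆ b → b ≡⋆ a
≡⋆-sym (inj₁ a≡b)         = inj₁ (sym a≡b)
≡⋆-sym (inj₂ (inj₁ a≡⋆))  = inj₂ (inj₂ a≡⋆)
≡⋆-sym (inj₂ (inj₂ b≡⋆))  = inj₂ (inj₁ b≡⋆)

module _ {n : ℕ} (I : Instance n) where

  private
    G = graph I
    K = k I

  entry : Fin n → Fin n → ℚ
  entry u x = if adj G u x then ew I u x else 0ℚ

  entry-adj : ∀ {u x} → T (adj G u x) → entry u x ≡ ew I u x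
  entry-adj {u} {x} u~x with adj G u x
  ... | true = refl

  A-offDiag : ∀ {u x} → u ≢ x → A I u x ≡ just (entry u x)
  A-offDiag {u} {x} u≢x with u Fin.≟ x
  ... | yes u≡x = ⊥-elim (u≢x u≡x)
  ... | no _ with adj G u x
  ...   | true  = refl
  ...   | false = refl

  A-diag-S : ∀ {v} → T (inS I v) → A I v v ≡ just (vw I v)
  A-diag-S {v} v∈S with v Fin.≟ v
  ... | no v≢v = ⊥-elim (v≢v refl)
  ... | yes _ with inS I v
  ...   | true = refl

  StarTwins-sym : ∀ {u v} → StarTwins I u v → StarTwins I v u
  StarTwins-sym {u} {v} (u≢v , u~v , rows) =
    u≢v ∘ sym , subst T (adj-sym G u v) u~v , ≡⋆-sym ∘ rows

  twin-entry : ∀ {u v x} → StarTwins I u v → x ≢ u → x ≢ v → entry u x ≡ entry v x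
  twin-entry {x = x} (_ , _ , rows) x≢u x≢v =
    ≡⋆-just (subst₂ _≡⋆_ (A-offDiag (x≢u ∘ sym)) (A-offDiag (x≢v ∘ sym)) (rows x))

  twin-edge≡vertex : ∀ {u v} → StarTwins I u v → T (inS I v) → ew I u v ≡ vw I v
  twin-edge≡vertex {v = v} (u≢v , u~v , rows) v∈S =
    trans (sym (entry-adj u~v)) (≡⋆-just (subst₂ _≡⋆_ (A-offDiag u≢v) (A-diag-S v∈S) (rows v)))

  entry≤pairWeight : ∀ {c} → IsSolution I c → ∀ u x → entry u x ≤ pairWeight c u x
  entry≤pairWeight {c} sol u x with adj G u x in u~x
  ... | true  = ≤-reflexive (IsSolution.edge-eq sol u x (subst T (sym u~x) tt))
  ... | false = sumWhere-nonneg K (λ j → B c u j ∧ B c x j) (IsSolution.γ-nonneg sol)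

  Irredundant : Candidate n K → Set
  Irredundant c = ∀ v j → T (B c v j) →
    0ℚ < γ c j × (T (inS I v) ⊎ ∃ λ x → x ≢ v × T (B c x j))

  irredundant⇒no-twin-subset : ∀ {c} → IsSolution I c → Irredundant c →
                               ∀ {u v} → StarTwins I u v → ¬ (B c u ⊂sig B c v)
  irredundant⇒no-twin-subset {c} sol irr {u} {v} tw@(u≢v , u~v , _) (Bu⊆Bv , j , v∈Cj , u∉Cj)
    with irr v j v∈Cj
  ... | γj>0 , inj₁ v∈S = <-irrefl pair≡vertex pair<vertex
    where
    open ≡-Reasoning
    open IsSolution sol
    pair≡vertex : pairWeight c u v ≡ vertexWeight c v
    pair≡vertex = begin
      pairWeight c u v  ≡⟨ sym (edge-eq u v u~v) ⟩
      ew I u v          ≡⟨ twin-edge≡vertex tw v∈S ⟩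
      vw I v            ≡⟨ vertex-eq v v∈S ⟩
      vertexWeight c v  ∎
    pair<vertex : pairWeight c u v < vertexWeight c v
    pair<vertex = sumWhere-mono-< K γ-nonneg (λ i → proj₂ ∘ T-∧-elim) j
                    (u∉Cj ∘ proj₁ ∘ T-∧-elim) v∈Cj γj>0
  ... | γj>0 , inj₂ (x , x≢v , x∈Cj) = <-irrefl entry≡ entry<
    where
    open ≡-Reasoning
    open IsSolution sol
    x≢u : x ≢ u
    x≢u refl = u∉Cj x∈Cj
    v~x : T (adj G v x)
    v~x = cliques j v x (x≢v ∘ sym) v∈Cj x∈Cj
    entry≡ : entry u x ≡ pairWeight c v x
    entry≡ = begin
      entry u x         ≡⟨ twin-entry tw x≢u x≢v ⟩
      entry v x         ≡⟨ entry-adj v~x ⟩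
      ew I v x          ≡⟨ edge-eq v x v~x ⟩
      pairWeight c v x  ∎
    ux⊆vx : ∀ i → T (B c u i ∧ B c x i) → T (B c v i ∧ B c x i)
    ux⊆vx i ux = let u∈Ci , x∈Ci = T-∧-elim ux in T-∧-intro (Bu⊆Bv i u∈Ci) x∈Ci
    entry< : entry u x < pairWeight c v x
    entry< = ≤-<-trans (entry≤pairWeight sol u x)
               (sumWhere-mono-< K γ-nonneg ux⊆vx j
                  (u∉Cj ∘ proj₁ ∘ T-∧-elim) (T-∧-intro v∈Cj x∈Cj) γj>0)

  module _ (c : Candidate n K) where

    Essential : Fin n → Fin K → Set
    Essential v j = T (B c v j) × 0ℚ < γ c j × (T (inS I v) ⊎ ∃ λ x → x ≢ v × T (B c x j))

    essential? : ∀ v j → Dec (Essential v j)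
    essential? v j = T? (B c v j) ×-dec (0ℚ <? γ c j) ×-dec
      (T? (inS I v) ⊎-dec Fin.any? (λ x → ¬? (x Fin.≟ v) ×-dec T? (B c x j)))

    trim : Candidate n K
    trim = record { B = λ v j → ⌊ essential? v j ⌋ ; γ = γ c }

    trim-essential : ∀ {v j} → T (B trim v j) → Essential v j
    trim-essential = toWitness

    essential-trim : ∀ {v j} → Essential v j → T (B trim v j)
    essential-trim = fromWitness

    shared-trim : ∀ {u v j} → u ≢ v → T (B c u j) → T (B c v j) → 0ℚ < γ c j → T (B trim u j)
    shared-trim {v = v} u≢v u∈Cj v∈Cj γj>0 = essential-trim (u∈Cj , γj>0 , inj₂ (v , u≢v ∘ sym , v∈Cj))

    trim-irredundant : Irredundant trim
    trim-irredundant v j v∈Cj with trim-essential v∈Cj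
    ... | _    , γj>0 , inj₁ v∈S = γj>0 , inj₁ v∈S
    ... | v∈Cj , γj>0 , inj₂ (x , x≢v , x∈Cj) = γj>0 , inj₂ (x , x≢v , shared-trim x≢v x∈Cj v∈Cj γj>0)

    trim-solution : IsSolution I c → IsSolution I trim
    trim-solution sol = record
      { cliques   = λ j u v u≢v u∈Cj v∈Cj →
                      cliques j u v u≢v (proj₁ (trim-essential u∈Cj)) (proj₁ (trim-essential v∈Cj))
      ; γ-nonneg  = γ-nonneg
      ; edge-eq   = λ u v u~v → trans (edge-eq u v u~v)
                      (sym (sumFin-cong K (λ j → pair-term (adj⇒≢ u~v) j)))
      ; vertex-eq = λ v v∈S → trans (vertex-eq v v∈S) (sym (sumFin-cong K (vertex-term v∈S)))
      }
      where
      open IsSolution sol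

      adj⇒≢ : ∀ {u v} → T (adj G u v) → u ≢ v
      adj⇒≢ {u} u~u refl = subst T (adj-irr G u) u~u

      γ-pos-or-zero : ∀ j → 0ℚ < γ c j ⊎ γ c j ≡ 0ℚ
      γ-pos-or-zero j with 0ℚ <? γ c j
      ... | yes γj>0 = inj₁ γj>0
      ... | no  γj≯0 = inj₂ (≤-antisym (≮⇒≥ γj≯0) (γ-nonneg j))

      pair-term : ∀ {u v} → u ≢ v → ∀ j →
        (if B trim u j ∧ B trim v j then γ c j else 0ℚ) ≡ (if B c u j ∧ B c v j then γ c j else 0ℚ)
      pair-term {u} {v} u≢v j = if-0-cong trimmed untrimmed
        where
        trimmed : T (B trim u j ∧ B trim v j) → T (B c u j ∧ B c v j)
        trimmed uv = let u∈Cj , v∈Cj = T-∧-elim uv in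
          T-∧-intro (proj₁ (trim-essential u∈Cj)) (proj₁ (trim-essential v∈Cj))
        untrimmed : T (B c u j ∧ B c v j) → T (B trim u j ∧ B trim v j) ⊎ γ c j ≡ 0ℚ
        untrimmed uv with T-∧-elim uv | γ-pos-or-zero j
        ... | u∈Cj , v∈Cj | inj₁ γj>0 =
          inj₁ (T-∧-intro (shared-trim u≢v u∈Cj v∈Cj γj>0) (shared-trim (u≢v ∘ sym) v∈Cj u∈Cj γj>0))
        ... | _ | inj₂ γj≡0 = inj₂ γj≡0

      vertex-term : ∀ {v} → T (inS I v) → ∀ j →
        (if B trim v j then γ c j else 0ℚ) ≡ (if B c v j then γ c j else 0ℚ)
      vertex-term {v} v∈S j = if-0-cong (proj₁ ∘ trim-essential) untrimmed
        where
        untrimmed : T (B c v j) → T (B trim v j) ⊎ γ c j ≡ 0ℚ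
        untrimmed v∈Cj with γ-pos-or-zero j
        ... | inj₁ γj>0 = inj₁ (essential-trim (v∈Cj , γj>0 , inj₁ v∈S))
        ... | inj₂ γj≡0 = inj₂ γj≡0

lemma5p2 : ∀ {n : ℕ} (I : Instance n) → NoIsolated (graph I) → YesInstance I →
    Σ (Candidate n (k I)) λ c → IsSolution I c ×
      (∀ u v → StarTwins I u v → ¬ (B c u ⊂sig B c v) × ¬ (B c v ⊂sig B c u))
lemma5p2 I _ (c , sol) = trim I c , sol′ , λ u v tw → no-subset tw , no-subset (StarTwins-sym I tw)
  where
  sol′ : IsSolution I (trim I c)
  sol′ = trim-solution I c sol
  no-subset : ∀ {u v} → StarTwins I u v → ¬ (B (trim I c) u ⊂sig B (trim I c) v)
  no-subset = irredundant⇒no-twin-subset I sol′ (trim-irredundant I c)
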